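{- Let $\Gamma$ be a local type environment and $\mathbb{G}$ a global type tree (balanced, well-formed and projectable onto every participant). If $\Gamma\sqsubseteq\mathbb{G}$ then $\Gamma$ is live.
   Context: Sorts are $\mathtt{int},\mathtt{bool},\mathtt{nat}$; subsorting $\le$ is the least reflexive relation with $\mathtt{nat}\le\mathtt{int}$. Local type trees are defined coinductively by $T ::= \mathtt{end} \mid \mathtt{p}\&\{\ell_i(S_i).T_i\}_{i\in I} \mid \mathtt{p}\oplus\{\ell_i(S_i).T_i\}_{i\in I}$ with $I$ finite nonempty and the $\ell_i$ distinct. Subtyping $\le$ on local types is the largest relation such that: $\mathtt{end}\le\mathtt{end}$; $\mathtt{p}\&\{\ell_i(S_i).T_i\}_{i\in I\cup J}\le \mathtt{p}\&\{\ell_i(S'_i).T'_i\}_{i\in I}$ if for all $i\in I$, $S'_i\le S_i$ and $T_i\le T'_i$; $\mathtt{p}\oplus\{\ell_i(S_i).T_i\}_{i\in I}\le \mathtt{p}\oplus\{\ell_i(S'_i).T'_i\}_{i\in I\cup J}$ if for all $i\in I$, $S_i\le S'_i$ and $T_i\le T'_i$. Global type trees are defined coinductively by $\mathbb{G} ::= \mathtt{end} \mid \mathtt{p}\to\mathtt{q}:\{\ell_i(S_i).\mathbb{G}_i\}_{i\in I}$ ($I$ finite nonempty). $\mathrm{pt}(\mathbb{G})$ is the least solution of $\mathrm{pt}(\mathtt{end})=\emptyset$, $\mathrm{pt}(\mathtt{p}\to\mathtt{q}:\{\ell_i(S_i).\mathbb{G}_i\}_{i\in I})=\{\mathtt{p},\mathtt{q}\}\cup\bigcup_i\mathrm{pt}(\mathbb{G}_i)$.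 Projection $\upharpoonright_{\mathtt{r}}$ is the largest relation between global and local type trees such that whenever $\mathbb{G}\upharpoonright_{\mathtt{r}}T$: if $\mathtt{r}\notin\mathrm{pt}(\mathbb{G})$ then $T=\mathtt{end}$; if $\mathbb{G}=\mathtt{p}\to\mathtt{r}:\{\ell_i(S_i).\mathbb{G}_i\}_{i\in I}$ then $T=\mathtt{p}\&\{\ell_i(S_i).T_i\}_{i\in I}$ with $\mathbb{G}_i\upharpoonright_{\mathtt{r}}T_i$; if $\mathbb{G}=\mathtt{r}\to\mathtt{q}:\{\ell_i(S_i).\mathbb{G}_i\}_{i\in I}$ then $T=\mathtt{q}\oplus\{\ell_i(S_i).T_i\}_{i\in I}$ with $\mathbb{G}_i\upharpoonright_{\mathtt{r}}T_i$; if $\mathbb{G}=\mathtt{p}\to\mathtt{q}:\{\ell_i(S_i).\mathbb{G}_i\}_{i\in I}$ with $\mathtt{r}\notin\{\mathtt{p},\mathtt{q}\}$ then $\mathbb{G}_i\upharpoonright_{\mathtt{r}}T$ for all $i$. Projection is functional; write $\mathbb{G}\upharpoonright\mathtt{r}$. $\mathbb{G}$ is balanced if for every subtree $\mathbb{G}'$ there is $k$ such that every $\mathtt{p}\in\mathrm{pt}(\mathbb{G}')$ occurs on every path from the root of $\mathbb{G}'$ of length at least $k$ or ending in $\mathtt{end}$. A local type environment $\Gamma$ is a finite map from participants to local type trees (compared by extensional equality); $\Gamma_1,\Gamma_2$ denotes union with disjoint domains. Environment transitions are the least relation with: $\mathtt{p}:\mathtt{q}\&\{\ell_i(S_i).T_i\}_{i\in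 I}\xrightarrow{\mathtt{p}:\mathtt{q}\&\ell_k(S_k)}\mathtt{p}:T_k$ and $\mathtt{p}:\mathtt{q}\oplus\{\ell_i(S_i).T_i\}_{i\in I}\xrightarrow{\mathtt{p}:\mathtt{q}\oplus\ell_k(S_k)}\mathtt{p}:T_k$ for $k\in I$; if $\Gamma\xrightarrow{\alpha}\Gamma'$ then $\Gamma,\mathtt{p}:T\xrightarrow{\alpha}\Gamma',\mathtt{p}:T$; if $\Gamma_1\xrightarrow{\mathtt{p}:\mathtt{q}\oplus\ell(S)}\Gamma_1'$, $\Gamma_2\xrightarrow{\mathtt{q}:\mathtt{p}\&\ell(S')}\Gamma_2'$ and $S\le S'$ then $\Gamma_1,\Gamma_2\xrightarrow{(\mathtt{p},\mathtt{q})\ell}\Gamma'_1,\Gamma'_2$. Write $\Gamma\xrightarrow{\alpha}$ if $\Gamma\xrightarrow{\alpha}\Gamma'$ for some $\Gamma'$; $\Gamma\to\Gamma'$ if $\Gamma\xrightarrow{(\mathtt{p},\mathtt{q})\ell}\Gamma'$ for some $\mathtt{p},\mathtt{q},\ell$; $\to^*$ is its reflexive transitive closure. Association: $\Gamma\sqsubseteq\mathbb{G}$ iff for all $\mathtt{p}\in\mathrm{pt}(\mathbb{G})$, $\mathtt{p}\in\mathrm{dom}(\Gamma)$ and $\Gamma(\mathtt{p})\le\mathbb{G}\upharpoonright\mathtt{p}$, and for all $\mathtt{p}\notin\mathrm{pt}(\mathbb{G})$, either $\mathtt{p}\notin\mathrm{dom}(\Gamma)$ or $\Gamma(\mathtt{p})=\mathtt{end}$.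 A reduction path is a finite or infinite sequence $\Gamma_0\xrightarrow{\lambda_0}\Gamma_1\xrightarrow{\lambda_1}\cdots$ where each $\lambda_i$ has the form $(\mathtt{p},\mathtt{q})\ell$; let $N$ be its set of valid indices. It is fair if for all $n\in N$, $\Gamma_n\xrightarrow{(\mathtt{p},\mathtt{q})\ell}$ implies there exist $k\ge n$ and $\ell'$ with $\lambda_k=(\mathtt{p},\mathtt{q})\ell'$. It is live if for all $n\in N$: $\Gamma_n\xrightarrow{\mathtt{p}:\mathtt{q}\oplus\ell(S)}$ implies there exist $k\in N$, $k\ge n$, and $\ell'$ with $\Gamma_k\xrightarrow{(\mathtt{p},\mathtt{q})\ell'}\Gamma_{k+1}$ being the $k$-th step of the path; and $\Gamma_n\xrightarrow{\mathtt{q}:\mathtt{p}\&\ell(S)}$ implies there exist $k\in N$, $k\ge n$, and $\ell'$ with $\Gamma_k\xrightarrow{(\mathtt{p},\mathtt{q})\ell'}\Gamma_{k+1}$ being the $k$-th step. An environment $\Gamma$ is live if whenever $\Gamma\to^*\Gamma'$, every fair path starting from $\Gamma'$ is live. -}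

module Defs where

open import Data.Nat using (ℕ; zero; suc; _≤_; _<_)
open import Data.Fin using (Fin)
open import Data.Product using (Σ; ∃; _×_; _,_; proj₁; proj₂)
open import Data.Sum using (_⊎_)
open import Data.Unit using (⊤)
open import Data.Empty using (⊥)
open import Data.Maybe using (Maybe; just; nothing)
open import Data.List using (List)
open import Data.List.Membership.Propositional using (_∈_)
open import Relation.Nullary using (¬_)
open import Relation.Binary.PropositionalEquality using (_≡_; _≢_)
open import Relation.Binary.Construct.Closure.ReflexiveTransitive using (Star)
open import Function.Definitions using (Injective)

Part : Set
Part = ℕ

Label : Set
Label = ℕ

data Sort : Set where
  int bool nat : Sort

data _≤S_ : Sort → Sort → Set where
  ≤S-refl   : ∀ {S} → S ≤S S
  ≤S-natint : nat ≤S int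

-- A branching node carries a direction
-- (& = amp, ⊕ = plus), a participant, a finite nonempty family of
-- branches indexed by Fin (suc n), with pairwise distinct labels.

data Dir : Set where
  amp plus : Dir

mutual
  record LType : Set where
    coinductive
    field node : LNode

  data LNode : Set where
    lend : LNode
    lcom : Dir → Part → (n : ℕ) → (br : Fin (suc n) → Label × Sort × LType)
         → Injective _≡_ _≡_ (λ i → proj₁ (br i)) → LNode

open LType public

lab : ∀ {A : Set} → Label × Sort × A → Label
lab b = proj₁ b

srt : ∀ {A : Set} → Label × Sort × A → Sort
srt b = proj₁ (proj₂ b)

cnt : ∀ {A : Set} → Label × Sort × A → A
cnt b = proj₂ (proj₂ b)

IsEnd : LType → Set
IsEnd T = node T ≡ lend

-- Subtyping on local types: largest relation (coinductive record).
-- Branches are matched by label (labels are distinct within a node).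

mutual
  record _≤L_ (T U : LType) : Set where
    coinductive
    field unfold : SubStep (node T) (node U)

  SubStep : LNode → LNode → Set
  SubStep lend lend = ⊤
  SubStep (lcom amp p n br _) (lcom amp p' n' br' _) =
    p ≡ p' ×
    ((j : Fin (suc n')) → Σ (Fin (suc n)) λ i →
       lab (br i) ≡ lab (br' j) × srt (br' j) ≤S srt (br i) × cnt (br i) ≤L cnt (br' j))
  SubStep (lcom plus p n br _) (lcom plus p' n' br' _) =
    p ≡ p' ×
    ((i : Fin (suc n)) → Σ (Fin (suc n')) λ j →
       lab (br i) ≡ lab (br' j) × srt (br i) ≤S srt (br' j) × cnt (br i) ≤L cnt (br' j))
  SubStep _ _ = ⊥

-- Global type trees (coinductive).  Well-formedness built into nodes:
-- sender ≠ receiver, finite nonempty branch family, distinct labels.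

mutual
  record GType : Set where
    coinductive
    field gnode : GNode

  data GNode : Set where
    gend : GNode
    gcom : (p q : Part) → p ≢ q → (n : ℕ) → (br : Fin (suc n) → Label × Sort × GType)
         → Injective _≡_ _≡_ (λ i → proj₁ (br i)) → GNode

open GType public

InNode : Part → GNode → Set
InNode r gend = ⊥
InNode r (gcom p q _ _ _ _) = r ≡ p ⊎ r ≡ q

Choice : GNode → Set
Choice gend = ⊥
Choice (gcom _ _ _ n _ _) = Fin (suc n)

child : (g : GNode) → Choice g → GType
child (gcom _ _ _ _ br _) i = cnt (br i)

-- pt(G): least solution, i.e. an inductive predicate
data _∈pt_ (r : Part) (G : GType) : Set where
  top   : InNode r (gnode G) → r ∈pt G
  below : (i : Choice (gnode G)) → r ∈pt child (gnode G) i → r ∈pt G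

-- Projection: largest relation (coinductive record), given as the
-- conjunction of the four "whenever" clauses.

mutual
  record Proj (G : GType) (r : Part) (T : LType) : Set where
    coinductive
    field
      notPt : ¬ (r ∈pt G) → IsEnd T
      shape : ProjStep r (gnode G) T

  ProjStep : Part → GNode → LType → Set
  ProjStep r gend T = ⊤
  ProjStep r (gcom p q _ n br _) T =
    (r ≡ q → Match amp p n br r (node T)) ×
    (r ≡ p → Match plus q n br r (node T)) ×
    (r ≢ p → r ≢ q → (i : Fin (suc n)) → Proj (cnt (br i)) r T)

  data Match (d : Dir) (s : Part) (n : ℕ) (gbr : Fin (suc n) → Label × Sort × GType)
             (r : Part) : LNode → Set where
    match : (tbr : Fin (suc n) → Label × Sort × LType)
            {inj : Injective _≡_ _≡_ (λ i → proj₁ (tbr i))} →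
            ((i : Fin (suc n)) → lab (tbr i) ≡ lab (gbr i) × srt (tbr i) ≡ srt (gbr i)
                                 × Proj (cnt (gbr i)) r (cnt (tbr i))) →
            Match d s n gbr r (lcom d s n tbr inj)

Projectable : GType → Set
Projectable G = ∀ r → r ∈pt G → ∃ λ T → Proj G r T

data GPath (G : GType) : Set where
  []  : GPath G
  _∷_ : (i : Choice (gnode G)) → GPath (child (gnode G) i) → GPath G

plen : ∀ {G} → GPath G → ℕ
plen [] = zero
plen (i ∷ π) = suc (plen π)

target : ∀ {G} → GPath G → GType
target {G} [] = G
target (i ∷ π) = target π

Occurs : ∀ {G} → Part → GPath G → Set
Occurs r [] = ⊥
Occurs {G} r (i ∷ π) = InNode r (gnode G) ⊎ Occurs r π

-- subtrees of G are exactly the targets of paths from the root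
Balanced : GType → Set
Balanced G =
  (π : GPath G) → ∃ λ k → ∀ r → r ∈pt target π →
    (σ : GPath (target π)) → (k ≤ plen σ ⊎ gnode (target σ) ≡ gend) → Occurs r σ

record Env : Set where
  field
    map    : Part → Maybe LType
    dom    : List Part
    finite : ∀ p T → map p ≡ just T → p ∈ dom

open Env public

Single : Part → LType → Env → Set
Single p T Γ = ∀ r → (r ≡ p → map Γ r ≡ just T) × (r ≢ p → map Γ r ≡ nothing)

Union : Env → Env → Env → Set
Union Γ₁ Γ₂ Γ = ∀ r → (map Γ₁ r ≡ nothing × map Γ r ≡ map Γ₂ r)
                     ⊎ (map Γ₂ r ≡ nothing × map Γ r ≡ map Γ₁ r)

data Act : Set where
  recvA : Part → Part → Label → Sort → Act
  sendA : Part → Part → Label → Sort → Act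
  commA : Part → Part → Label → Act

data _—[_]→_ : Env → Act → Env → Set where
  ax-recv : ∀ {Γ Γ' p T q n br} {inj : Injective _≡_ _≡_ (λ i → lab {LType} (br i))} → Single p T Γ → node T ≡ lcom amp q n br inj →
            (k : Fin (suc n)) → Single p (cnt (br k)) Γ' →
            Γ —[ recvA p q (lab (br k)) (srt (br k)) ]→ Γ'
  ax-send : ∀ {Γ Γ' p T q n br} {inj : Injective _≡_ _≡_ (λ i → lab {LType} (br i))} → Single p T Γ → node T ≡ lcom plus q n br inj →
            (k : Fin (suc n)) → Single p (cnt (br k)) Γ' →
            Γ —[ sendA p q (lab (br k)) (srt (br k)) ]→ Γ'
  frame   : ∀ {Γ Γ' α p T Δ Θ Θ'} → Γ —[ α ]→ Γ' → Single p T Δ →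
            Union Γ Δ Θ → Union Γ' Δ Θ' → Θ —[ α ]→ Θ'
  sync    : ∀ {Γ₁ Γ₁' Γ₂ Γ₂' p q ℓ S S' Θ Θ'} →
            Γ₁ —[ sendA p q ℓ S ]→ Γ₁' → Γ₂ —[ recvA q p ℓ S' ]→ Γ₂' → S ≤S S' →
            Union Γ₁ Γ₂ Θ → Union Γ₁' Γ₂' Θ' → Θ —[ commA p q ℓ ]→ Θ'

_—[_]→ : Env → Act → Set
Γ —[ α ]→ = ∃ λ Γ' → Γ —[ α ]→ Γ'

_⟶_ : Env → Env → Set
Γ ⟶ Γ' = ∃ λ p → ∃ λ q → ∃ λ ℓ → Γ —[ commA p q ℓ ]→ Γ'

_⟶*_ : Env → Env → Set
_⟶*_ = Star _⟶_

_⊑_ : Env → GType → Set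
Γ ⊑ G =
  (∀ p → p ∈pt G → ∃ λ T → map Γ p ≡ just T × ∃ λ U → Proj G p U × T ≤L U) ×
  (∀ p → ¬ (p ∈pt G) → map Γ p ≡ nothing ⊎ (∃ λ T → map Γ p ≡ just T × IsEnd T))

-- Reduction paths (finite: len = just m, environments 0..m, steps 0..m-1;
-- infinite: len = nothing).

EnvIdx : Maybe ℕ → ℕ → Set
EnvIdx (just m) n = n ≤ m
EnvIdx nothing  n = ⊤

StepIdx : Maybe ℕ → ℕ → Set
StepIdx (just m) n = n < m
StepIdx nothing  n = ⊤

record RPath : Set where
  field
    len  : Maybe ℕ
    env  : ℕ → Env
    plab : ℕ → Part × Part × Label
    step : ∀ k → StepIdx len k →
           env k —[ commA (proj₁ (plab k)) (proj₁ (proj₂ (plab k))) (proj₂ (proj₂ (plab k))) ]→ env (suc k)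

open RPath public

Eventually : RPath → ℕ → Part → Part → Set
Eventually π n p q = ∃ λ k → n ≤ k × StepIdx (len π) k × ∃ λ ℓ' → plab π k ≡ (p , q , ℓ')

Fair : RPath → Set
Fair π = ∀ n → EnvIdx (len π) n → ∀ p q ℓ → env π n —[ commA p q ℓ ]→ → Eventually π n p q

LivePath : RPath → Set
LivePath π = ∀ n → EnvIdx (len π) n →
  (∀ p q ℓ S → env π n —[ sendA p q ℓ S ]→ → Eventually π n p q) ×
  (∀ p q ℓ S → env π n —[ recvA q p ℓ S ]→ → Eventually π n p q)

Live : Env → Set
Live Γ = ∀ Γ' → Γ ⟶* Γ' → ∀ (π : RPath) → (∀ r → map (env π 0) r ≡ map Γ' r) →
         Fair π → LivePath π

-- Association with a balanced global type is preserved by reduction. When the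
-- environment performs (r, s)ℓ, the global type G reduces to the tree in which,
-- on every path, the first r → s interaction is resolved to its ℓ-branch: such
-- an interaction exists within bounded depth because r's projection starts with
-- the send and G is balanced, and the projections of all participants survive.
-- So every environment on a path is associated with a balanced G, whose root
-- interaction is enabled. A pending action of x is then handled by induction on
-- the depth D of x's first occurrence in G: if x is at the root, the action is
-- the root interaction, which fairness eventually fires; otherwise fairness
-- eventually fires the root, until which x does not move and the root stays in
-- place, and afterwards x occurs within depth D - 1.

module Submission where

open import Defs
open import Data.Nat using (ℕ; zero; suc; _≤_; z≤n; s≤s; _⊔_; _+_; _∸_)
open import Data.Nat.Properties using (≤-refl; ≤-trans; m≤m⊔n; m≤n⊔m; n≤1+n; <⇒≤; +-suc; m+[n∸m]≡n; +-identityʳ; m≤m+n) renaming (_≟_ to _≟ℕ_)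
open import Data.Fin using (Fin) renaming (zero to fz; suc to fs)
open import Data.Fin.Properties using (any?)
open import Data.Product using (Σ; ∃; _×_; _,_; proj₁; proj₂)
open import Data.Sum using (_⊎_; inj₁; inj₂; map₁)
open import Data.Unit using (tt)
open import Data.Empty using (⊥; ⊥-elim)
open import Data.Maybe using (Maybe; just; nothing)
open import Data.Maybe.Properties using (just-injective)
open import Data.List using (List; []; _∷_)
open import Data.List.Relation.Unary.Any using (here; there)
import Data.List.Relation.Unary.Any as Any
open import Data.List.Membership.Propositional using (_∈_)
open import Relation.Nullary using (¬_; Dec; yes; no)
open import Relation.Nullary.Decidable.Core using (_⊎-dec_; _×-dec_)
open import Relation.Binary.PropositionalEquality using (_≡_; _≢_; refl; sym; trans; cong; cong₂; subst; module ≡-Reasoning)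
open import Relation.Binary.Construct.Closure.ReflexiveTransitive using (ε; _◅_)
open import Function.Definitions using (Injective)

Branches : Set → ℕ → Set
Branches A n = Fin (suc n) → Label × Sort × A

DistinctLabels : ∀ {A n} → Branches A n → Set
DistinctLabels br = Injective _≡_ _≡_ (λ i → lab (br i))

≤S-trans : ∀ {S₁ S₂ S₃} → S₁ ≤S S₂ → S₂ ≤S S₃ → S₁ ≤S S₃
≤S-trans ≤S-refl    le       = le
≤S-trans ≤S-natint  ≤S-refl  = ≤S-natint

lcom≢lend : ∀ {nd d w n} {br : Branches LType n} {inj : DistinctLabels br} →
            nd ≡ lcom d w n br inj → nd ≢ lend
lcom≢lend refl ()

lcom-injective : ∀ {d d′ w w′ n n′} {br : Branches LType n} {br′ : Branches LType n′}
                 {inj : DistinctLabels br} {inj′ : DistinctLabels br′} →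
                 lcom d w n br inj ≡ lcom d′ w′ n′ br′ inj′ → d ≡ d′ × w ≡ w′
lcom-injective refl = refl , refl

isEnd? : (T : LType) → Dec (IsEnd T)
isEnd? T with node T
... | lend             = yes refl
... | lcom _ _ _ _ _   = no λ ()

≤L-reflects-end : ∀ {T U} → T ≤L U → IsEnd U → IsEnd T
≤L-reflects-end {T} {U} le = go (node T) (node U) (_≤L_.unfold le)
  where
    go : ∀ nd nd′ → SubStep nd nd′ → nd′ ≡ lend → nd ≡ lend
    go lend                 lend _  _ = refl
    go (lcom plus _ _ _ _)  lend () _
    go (lcom amp _ _ _ _)   lend () _

≤L-preserves-end : ∀ {T U} → T ≤L U → IsEnd T → IsEnd U
≤L-preserves-end {T} {U} le = go (node T) (node U) (_≤L_.unfold le)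
  where
    go : ∀ nd nd′ → SubStep nd nd′ → nd ≡ lend → nd′ ≡ lend
    go lend lend                 _  _ = refl
    go lend (lcom _ _ _ _ _)     () _

SubBranches⊕ : ∀ {n n′} → Branches LType n → Branches LType n′ → Set
SubBranches⊕ {n} {n′} br br′ = (i : Fin (suc n)) → Σ (Fin (suc n′)) λ j →
  lab (br i) ≡ lab (br′ j) × srt (br i) ≤S srt (br′ j) × cnt (br i) ≤L cnt (br′ j)

SubBranches& : ∀ {n n′} → Branches LType n → Branches LType n′ → Set
SubBranches& {n} {n′} br br′ = (j : Fin (suc n′)) → Σ (Fin (suc n)) λ i →
  lab (br i) ≡ lab (br′ j) × srt (br′ j) ≤S srt (br i) × cnt (br i) ≤L cnt (br′ j)

subStep-⊕ˡ : ∀ {q n nd′} {br : Branches LType n} {inj : DistinctLabels br} →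
             SubStep (lcom plus q n br inj) nd′ →
             ∃ λ n′ → Σ (Branches LType n′) λ br′ → Σ (DistinctLabels br′) λ inj′ →
               nd′ ≡ lcom plus q n′ br′ inj′ × SubBranches⊕ br br′
subStep-⊕ˡ {nd′ = lcom plus _ n′ br′ inj′} (refl , sub) = n′ , br′ , inj′ , refl , sub

subStep-&ˡ : ∀ {q n nd′} {br : Branches LType n} {inj : DistinctLabels br} →
             SubStep (lcom amp q n br inj) nd′ →
             ∃ λ n′ → Σ (Branches LType n′) λ br′ → Σ (DistinctLabels br′) λ inj′ →
               nd′ ≡ lcom amp q n′ br′ inj′ × SubBranches& br br′
subStep-&ˡ {nd′ = lcom amp _ n′ br′ inj′} (refl , sub) = n′ , br′ , inj′ , refl , sub

subStep-⊕ʳ : ∀ {q n′ nd} {br′ : Branches LType n′} {inj′ : DistinctLabels br′} →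
             SubStep nd (lcom plus q n′ br′ inj′) →
             ∃ λ n → Σ (Branches LType n) λ br → Σ (DistinctLabels br) λ inj →
               nd ≡ lcom plus q n br inj × SubBranches⊕ br br′
subStep-⊕ʳ {nd = lcom plus _ n br inj} (refl , sub) = n , br , inj , refl , sub

subStep-&ʳ : ∀ {q n′ nd} {br′ : Branches LType n′} {inj′ : DistinctLabels br′} →
             SubStep nd (lcom amp q n′ br′ inj′) →
             ∃ λ n → Σ (Branches LType n) λ br → Σ (DistinctLabels br) λ inj →
               nd ≡ lcom amp q n br inj × SubBranches& br br′
subStep-&ʳ {nd = lcom amp _ n br inj} (refl , sub) = n , br , inj , refl , sub

-- Reducing a global type builds new nodes, so participation and projection
-- are restated for nodes rather than for (coinductive) global types.

fromNode : GNode → GType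
gnode (fromNode g) = g

data _∈ptᴺ_ (t : Part) : GNode → Set where
  top   : ∀ {g} → InNode t g → t ∈ptᴺ g
  below : ∀ {g} (i : Choice g) → t ∈ptᴺ gnode (child g i) → t ∈ptᴺ g

∈pt⇒∈ptᴺ : ∀ {t G} → t ∈pt G → t ∈ptᴺ gnode G
∈pt⇒∈ptᴺ (top x)     = top x
∈pt⇒∈ptᴺ (below i h) = below i (∈pt⇒∈ptᴺ h)

∈ptᴺ⇒∈pt : ∀ {t G} → t ∈ptᴺ gnode G → t ∈pt G
∈ptᴺ⇒∈pt (top x)               = top x
∈ptᴺ⇒∈pt {G = G} (below i h)   = below i (∈ptᴺ⇒∈pt {G = child (gnode G) i} h)

∉ptᴺ-gend : ∀ {t} → ¬ t ∈ptᴺ gend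
∉ptᴺ-gend (top ())
∉ptᴺ-gend (below () _)

inNode? : (t : Part) (g : GNode) → Dec (InNode t g)
inNode? t gend               = no λ ()
inNode? t (gcom p q _ _ _ _) = (t ≟ℕ p) ⊎-dec (t ≟ℕ q)

Projᴺ : GNode → Part → LType → Set
Projᴺ g t U = (¬ t ∈ptᴺ g → IsEnd U) × ProjStep t g U

Proj⇒Projᴺ : ∀ {G t U} → Proj G t U → Projᴺ (gnode G) t U
Proj⇒Projᴺ pr = (λ t∉ → Proj.notPt pr (λ t∈ → t∉ (∈pt⇒∈ptᴺ t∈))) , Proj.shape pr

Projᴺ⇒Proj : ∀ {G t U} → Projᴺ (gnode G) t U → Proj G t U
Projᴺ⇒Proj pr = record
  { notPt = λ t∉ → proj₁ pr (λ t∈ → t∉ (∈ptᴺ⇒∈pt t∈)) ; shape = proj₂ pr }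

unmatch : ∀ {d w n t nd} {br : Branches GType n} → Match d w n br t nd →
          Σ (Branches LType n) λ tbr → Σ (DistinctLabels tbr) λ tinj → nd ≡ lcom d w n tbr tinj ×
            ((i : Fin (suc n)) → lab (tbr i) ≡ lab (br i) × srt (tbr i) ≡ srt (br i)
                                 × Proj (cnt (br i)) t (cnt (tbr i)))
unmatch (match tbr {inj} f) = tbr , inj , refl , f

projStep-top-¬end : ∀ {t U} g → ProjStep t g U → InNode t g → ¬ IsEnd U
projStep-top-¬end (gcom _ _ _ _ _ _) (_ , out , _) (inj₁ t≡p) with unmatch (out t≡p)
... | _ , _ , eq , _ = lcom≢lend eq
projStep-top-¬end (gcom _ _ _ _ _ _) (inp , _ , _) (inj₂ t≡q) with unmatch (inp t≡q)
... | _ , _ , eq , _ = lcom≢lend eq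

projStep-child : ∀ {t U} g → ProjStep t g U → ¬ InNode t g →
                 (i : Choice g) → Projᴺ (gnode (child g i)) t U
projStep-child (gcom _ _ _ _ _ _) (_ , _ , passive) ¬x i =
  Proj⇒Projᴺ (passive (λ e → ¬x (inj₁ e)) (λ e → ¬x (inj₂ e)) i)

projᴺ-end⇒∉ptᴺ : ∀ {t g U} → Projᴺ g t U → IsEnd U → ¬ t ∈ptᴺ g
projᴺ-end⇒∉ptᴺ {g = gend} _ _ (top ())
projᴺ-end⇒∉ptᴺ {g = g@(gcom _ _ _ _ _ _)} (_ , ps) end (top x) = projStep-top-¬end g ps x end
projᴺ-end⇒∉ptᴺ {t} {g = g@(gcom _ _ _ _ _ _)} (_ , ps) end (below i h) with inNode? t g
... | yes x = projStep-top-¬end g ps x end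
... | no ¬x = projᴺ-end⇒∉ptᴺ (projStep-child g ps ¬x i) end h

-- OccursWithin t D g: along every path from g, t is sender or receiver of one
-- of the first D + 1 interactions, unless the path reaches end first.
data OccursWithin (t : Part) : ℕ → GNode → Set where
  ended : ∀ {D} → OccursWithin t D gend
  now  : ∀ {D p q p≢q n} {br : Branches GType n} {inj : DistinctLabels br} →
         InNode t (gcom p q p≢q n br inj) → OccursWithin t D (gcom p q p≢q n br inj)
  next : ∀ {D p q p≢q n} {br : Branches GType n} {inj : DistinctLabels br} →
         ¬ InNode t (gcom p q p≢q n br inj) →
         ((i : Fin (suc n)) → OccursWithin t D (gnode (cnt (br i)))) →
         OccursWithin t (suc D) (gcom p q p≢q n br inj)

occursWithin-now : ∀ {t D} g → InNode t g → OccursWithin t D g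
occursWithin-now (gcom _ _ _ _ _ _) x = now x

occursWithin-next : ∀ {t D} g → ¬ InNode t g →
                    ((i : Choice g) → OccursWithin t D (gnode (child g i))) → OccursWithin t (suc D) g
occursWithin-next gend               _  _  = ended
occursWithin-next (gcom _ _ _ _ _ _) ¬x ch = next ¬x ch

occursWithin-mono : ∀ {t D D′ g} → D ≤ D′ → OccursWithin t D g → OccursWithin t D′ g
occursWithin-mono _        ended        = ended
occursWithin-mono _        (now x)     = now x
occursWithin-mono (s≤s le) (next ¬x ch) = next ¬x (λ i → occursWithin-mono le (ch i))

uniform-bound : ∀ {m} (Q : Fin m → ℕ → Set) → (∀ {i D D′} → D ≤ D′ → Q i D → Q i D′) →
                ((i : Fin m) → ∃ (Q i)) → ∃ λ D → (i : Fin m) → Q i D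
uniform-bound {zero}  Q mono h = zero , λ ()
uniform-bound {suc m} Q mono h with uniform-bound (λ i → Q (fs i)) mono (λ i → h (fs i)) | h fz
... | D , q | D₀ , q₀ =
  D₀ ⊔ D , λ { fz → mono (m≤m⊔n D₀ D) q₀ ; (fs i) → mono (m≤n⊔m D₀ D) (q i) }

-- Participation in an infinite tree is not decidable in general; a bound makes it so.
∈ptᴺ? : ∀ {t D g} → OccursWithin t D g → Dec (t ∈ptᴺ g)
∈ptᴺ? ended        = no ∉ptᴺ-gend
∈ptᴺ? (now x)      = yes (top x)
∈ptᴺ? (next ¬x ch) with any? (λ i → ∈ptᴺ? (ch i))
... | yes (i , h) = yes (below i h)
... | no ¬h       = no λ { (top x) → ¬x x ; (below i h) → ¬h (i , h) }

data Pathᴺ : GNode → Set where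
  []  : ∀ {g} → Pathᴺ g
  _∷_ : ∀ {g} (i : Choice g) → Pathᴺ (gnode (child g i)) → Pathᴺ g

targetᴺ : ∀ {g} → Pathᴺ g → GNode
targetᴺ {g} []  = g
targetᴺ (_ ∷ σ) = targetᴺ σ

-- Stated for ¬¬-participants because association only shows that a participant
-- with a non-end type is not absent; given a bound, ∈ptᴺ? recovers participation.
Bounded : GNode → Set
Bounded g = ∀ t → ¬ ¬ t ∈ptᴺ g → ∃ λ D → OccursWithin t D g

HereditarilyBounded : GNode → Set
HereditarilyBounded g = (σ : Pathᴺ g) → Bounded (targetᴺ σ)

hereditarilyBounded-child : ∀ {g} → HereditarilyBounded g → (i : Choice g) →
                            HereditarilyBounded (gnode (child g i))
hereditarilyBounded-child hb i σ = hb (i ∷ σ)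

∈ptᴺ-stable : ∀ {t g} → HereditarilyBounded g → ¬ ¬ t ∈ptᴺ g → t ∈ptᴺ g
∈ptᴺ-stable {t} hb ¬¬t∈ with ∈ptᴺ? (proj₂ (hb [] t ¬¬t∈))
... | yes t∈ = t∈
... | no  t∉ = ⊥-elim (¬¬t∈ t∉)

module _ (t : Part) where

  AllLongPathsMeet : ℕ → GType → Set
  AllLongPathsMeet k H = (σ : GPath H) → (k ≤ plen σ ⊎ gnode (target σ) ≡ gend) → Occurs t σ

  allLongPathsMeet-child : ∀ {k H} → AllLongPathsMeet (suc k) H → ¬ InNode t (gnode H) →
                           (i : Choice (gnode H)) → AllLongPathsMeet k (child (gnode H) i)
  allLongPathsMeet-child meet ¬x i σ long with meet (i ∷ σ) (map₁ s≤s long)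
  ... | inj₁ x   = ⊥-elim (¬x x)
  ... | inj₂ occ = occ

  occursWithin-from-paths : ∀ k H → ¬ ¬ AllLongPathsMeet k H → OccursWithin t k (gnode H)
  occursWithin-from-paths k H ¬¬meet with inNode? t (gnode H)
  ... | yes x = occursWithin-now (gnode H) x
  occursWithin-from-paths zero    H ¬¬meet | no ¬x = ⊥-elim (¬¬meet λ meet → meet [] (inj₁ z≤n))
  occursWithin-from-paths (suc k) H ¬¬meet | no ¬x = occursWithin-next (gnode H) ¬x λ i →
    occursWithin-from-paths k (child (gnode H) i)
      λ ¬meet → ¬¬meet λ meet → ¬meet (allLongPathsMeet-child meet ¬x i)

balanced⇒hereditarilyBounded : ∀ G → Balanced G → HereditarilyBounded (gnode G)
balanced⇒hereditarilyBounded G bal [] t ¬¬t∈ with bal []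
... | k , meet =
  k , occursWithin-from-paths t k G λ ¬meet → ¬¬t∈ λ t∈ → ¬meet (meet t (∈ptᴺ⇒∈pt t∈))
balanced⇒hereditarilyBounded G bal (i ∷ σ) =
  balanced⇒hereditarilyBounded (child (gnode G) i) (λ π → bal (i ∷ π)) σ

match-head : ∀ {d d′ w w′ n n′ u nd} {gbr : Branches GType n′} {br : Branches LType n}
             {inj : DistinctLabels br} →
             nd ≡ lcom d w n br inj → Match d′ w′ n′ gbr u nd → d ≡ d′ × w ≡ w′
match-head shape m with unmatch m
... | _ , _ , eq , _ = lcom-injective (trans (sym shape) eq)

module Fire (r s : Part) (ℓ : Label) where

  FiresAtRoot : GNode → Set
  FiresAtRoot gend               = ⊥
  FiresAtRoot (gcom p q _ _ _ _) = p ≡ r × q ≡ s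

  data _⇝_ : GNode → GNode → Set where
    fire : ∀ {r≢s n} {br : Branches GType n} {inj : DistinctLabels br} (i : Fin (suc n)) →
           lab (br i) ≡ ℓ → gcom r s r≢s n br inj ⇝ gnode (cnt (br i))
    skip : ∀ {p q p≢q n} {br : Branches GType n} {inj : DistinctLabels br} →
           ¬ FiresAtRoot (gcom p q p≢q n br inj) →
           (cs : Fin (suc n) → GType) → ((i : Fin (suc n)) → gnode (cnt (br i)) ⇝ gnode (cs i)) →
           gcom p q p≢q n br inj ⇝ gcom p q p≢q n (λ i → lab (br i) , srt (br i) , cs i) inj

  data Role : Part → Dir → Part → Set where
    sender   : Role r plus s
    receiver : Role s amp r

  record RoleProj (u : Part) (d : Dir) (w : Part) (g : GNode) : Set where
    constructor roleProj
    field
      U     : LType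
      proj  : Projᴺ g u U
      n     : ℕ
      br    : Branches LType n
      inj   : DistinctLabels br
      shape : node U ≡ lcom d w n br inj

  Ready : Part → Dir → Part → GNode → Set
  Ready u d w g = Σ (RoleProj u d w g) λ rp → ∃ λ j → lab (RoleProj.br rp j) ≡ ℓ

  continuation : ∀ {u d w g} → Ready u d w g → LType
  continuation (rp , j , _) = cnt (RoleProj.br rp j)

  roleMatch : ∀ {u d w n nd} {A : Set} {br : Branches GType n} → Role u d w →
              (u ≡ s → Match amp r n br u nd) × (u ≡ r → Match plus s n br u nd) × A →
              Match d w n br u nd
  roleMatch sender   (_ , out , _) = out refl
  roleMatch receiver (inp , _ , _) = inp refl

  roleProj-top : ∀ {u d w g} → Role u d w → RoleProj u d w g → InNode u g → FiresAtRoot g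
  roleProj-top {g = gcom _ _ _ _ _ _} sender (roleProj _ (_ , _ , out , _) _ _ _ shape) (inj₁ refl)
    with match-head shape (out refl)
  ... | _ , refl = refl , refl
  roleProj-top {g = gcom _ _ _ _ _ _} sender (roleProj _ (_ , inp , _ , _) _ _ _ shape) (inj₂ refl)
    with match-head shape (inp refl)
  ... | () , _
  roleProj-top {g = gcom _ _ _ _ _ _} receiver (roleProj _ (_ , _ , out , _) _ _ _ shape) (inj₁ refl)
    with match-head shape (out refl)
  ... | () , _
  roleProj-top {g = gcom _ _ _ _ _ _} receiver (roleProj _ (_ , inp , _ , _) _ _ _ shape) (inj₂ refl)
    with match-head shape (inp refl)
  ... | _ , refl = refl , refl

  roleProj-child : ∀ {u d w g} → Role u d w → RoleProj u d w g → ¬ FiresAtRoot g →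
                   (i : Choice g) → RoleProj u d w (gnode (child g i))
  roleProj-child {g = g} ro rp@(roleProj U (_ , ps) n br inj shape) ¬fires i =
    roleProj U (projStep-child g ps (λ x → ¬fires (roleProj-top ro rp x)) i) n br inj shape

  ready-child : ∀ {u d w g} → Role u d w → Ready u d w g → ¬ FiresAtRoot g →
                (i : Choice g) → Ready u d w (gnode (child g i))
  ready-child {g = gcom _ _ _ _ _ _} ro (rp , jℓ) ¬fires i = roleProj-child ro rp ¬fires i , jℓ

  module _ {u : Part} {d : Dir} {w : Part} {r≢s : r ≢ s} {n : ℕ}
           {br : Branches GType n} {inj : DistinctLabels br} (ro : Role u d w) where

    -- Labels are distinct, so the ℓ-branch of the projection is the projection of the ℓ-branch.
    ready-fire : (rr : Ready u d w (gcom r s r≢s n br inj)) (i : Fin (suc n)) → lab (br i) ≡ ℓ →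
                 Proj (cnt (br i)) u (continuation rr)
    ready-fire (roleProj _ (_ , ps) _ ubr uinj shape , j , lab-j) i lab-i with unmatch (roleMatch ro ps)
    ... | _ , _ , eq , f with trans (sym eq) shape
    ... | refl = subst (λ k → Proj (cnt (br i)) u (cnt (ubr k)))
                       (uinj (trans (proj₁ (f i)) (trans lab-i (sym lab-j)))) (proj₂ (proj₂ (f i)))

    roleProj-label⁺ : (rp : RoleProj u d w (gcom r s r≢s n br inj)) (i : Fin (suc n)) → lab (br i) ≡ ℓ →
                      ∃ λ j → lab (RoleProj.br rp j) ≡ ℓ
    roleProj-label⁺ (roleProj _ (_ , ps) _ _ _ shape) i lab-i with unmatch (roleMatch ro ps)
    ... | _ , _ , eq , f with trans (sym eq) shape
    ... | refl = i , trans (proj₁ (f i)) lab-i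

    roleProj-label⁻ : (rp : RoleProj u d w (gcom r s r≢s n br inj)) (j : Fin (suc (RoleProj.n rp))) →
                      lab (RoleProj.br rp j) ≡ ℓ → ∃ λ i → lab (br i) ≡ ℓ
    roleProj-label⁻ (roleProj _ (_ , ps) _ _ _ shape) j lab-j with unmatch (roleMatch ro ps)
    ... | _ , _ , eq , f with trans (sym eq) shape
    ... | refl = j , trans (sym (proj₁ (f j))) lab-j

  ⇝-∈ptᴺ : ∀ {t g g′} → g ⇝ g′ → t ∈ptᴺ g′ → t ∈ptᴺ g
  ⇝-∈ptᴺ (fire i _)         t∈          = below i t∈
  ⇝-∈ptᴺ (skip _ _ _)       (top x)     = top x
  ⇝-∈ptᴺ (skip _ _ subs)    (below i h) = below i (⇝-∈ptᴺ (subs i) h)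

  ⇝-occursWithin : ∀ {t D g g′} → t ≢ r → t ≢ s → g ⇝ g′ →
                   OccursWithin t D g → OccursWithin t D g′
  ⇝-occursWithin t≢r t≢s (fire _ _)      (now (inj₁ t≡r)) = ⊥-elim (t≢r t≡r)
  ⇝-occursWithin t≢r t≢s (fire _ _)      (now (inj₂ t≡s)) = ⊥-elim (t≢s t≡s)
  ⇝-occursWithin t≢r t≢s (fire i _)      (next _ ch)      = occursWithin-mono (n≤1+n _) (ch i)
  ⇝-occursWithin t≢r t≢s (skip _ _ _)    (now x)          = now x
  ⇝-occursWithin t≢r t≢s (skip _ _ subs) (next ¬x ch)     =
    next ¬x λ i → ⇝-occursWithin t≢r t≢s (subs i) (ch i)

  mutual
    ⇝-projᴺ-uninvolved : ∀ {t g g′ T} → t ≢ r → t ≢ s → g ⇝ g′ → Projᴺ g t T → Projᴺ g′ t T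
    ⇝-projᴺ-uninvolved t≢r t≢s red (_ , ps) = ⇝-notPt t≢r t≢s red ps , ⇝-projStep t≢r t≢s red ps

    ⇝-notPt : ∀ {t g g′ T} → t ≢ r → t ≢ s → g ⇝ g′ → ProjStep t g T → ¬ t ∈ptᴺ g′ → IsEnd T
    ⇝-notPt t≢r t≢s (fire i _) (_ , _ , passive) t∉ =
      Proj.notPt (passive t≢r t≢s i) λ t∈ → t∉ (∈pt⇒∈ptᴺ t∈)
    ⇝-notPt {t} {g} t≢r t≢s (skip _ _ subs) ps t∉ with inNode? t g
    ... | yes x = ⊥-elim (t∉ (top x))
    ... | no ¬x =
      proj₁ (⇝-projᴺ-uninvolved t≢r t≢s (subs fz) (projStep-child g ps ¬x fz)) λ t∈ → t∉ (below fz t∈)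

    ⇝-projStep : ∀ {t g g′ T} → t ≢ r → t ≢ s → g ⇝ g′ → ProjStep t g T → ProjStep t g′ T
    ⇝-projStep t≢r t≢s (fire i _) (_ , _ , passive) = Proj.shape (passive t≢r t≢s i)
    ⇝-projStep {t} t≢r t≢s (skip {n = n} {br} _ cs subs) (inp , out , passive) =
      (λ e → ⇝-match (inp e)) , (λ e → ⇝-match (out e)) ,
      λ t≢p t≢q i →
        Projᴺ⇒Proj (⇝-projᴺ-uninvolved t≢r t≢s (subs i) (Proj⇒Projᴺ (passive t≢p t≢q i)))
      where
        ⇝-match : ∀ {d w nd} → Match d w n br t nd →
                  Match d w n (λ i → lab (br i) , srt (br i) , cs i) t nd
        ⇝-match m with unmatch m
        ... | tbr , tinj , refl , f = match tbr {tinj} λ i →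
          proj₁ (f i) , proj₁ (proj₂ (f i)) ,
          Projᴺ⇒Proj (⇝-projᴺ-uninvolved t≢r t≢s (subs i) (Proj⇒Projᴺ (proj₂ (proj₂ (f i)))))

  ⇝-projᴺ-role : ∀ {u d w g g′} → Role u d w → g ⇝ g′ →
                 (rr : Ready u d w g) → Projᴺ g′ u (continuation rr)
  ⇝-projᴺ-role ro (fire i lab-i) rr = Proj⇒Projᴺ (ready-fire ro rr i lab-i)
  ⇝-projᴺ-role {u} {g = g} ro (skip ¬fires cs subs) rr@(rp , _) =
    (λ u∉ → proj₁ (childProj fz) λ u∈ → u∉ (below fz u∈)) ,
    (λ e → ⊥-elim (¬top (inj₂ e))) , (λ e → ⊥-elim (¬top (inj₁ e))) ,
    λ _ _ i → Projᴺ⇒Proj (childProj i)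
    where
      ¬top : ¬ InNode u g
      ¬top x = ¬fires (roleProj-top ro rp x)
      childProj : ∀ i → Projᴺ (gnode (cs i)) u (continuation rr)
      childProj i = ⇝-projᴺ-role ro (subs i) (ready-child ro rr ¬fires i)

  ⇝-label : ∀ {u d w g g′} → Role u d w → g ⇝ g′ →
            (rp : RoleProj u d w g) → ∃ λ j → lab (RoleProj.br rp j) ≡ ℓ
  ⇝-label ro (fire i lab-i)      rp = roleProj-label⁺ ro rp i lab-i
  ⇝-label ro (skip ¬fires _ subs) rp = ⇝-label ro (subs fz) (roleProj-child ro rp ¬fires fz)

  ⇝-occursWithin-role : ∀ {u d w g g′} → Role u d w → g ⇝ g′ → HereditarilyBounded g →
                        (rr : Ready u d w g) → ¬ IsEnd (continuation rr) → ∃ λ D → OccursWithin u D g′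
  ⇝-occursWithin-role {u} ro (fire i lab-i) hb rr ¬end =
    hb (i ∷ []) u λ u∉ → ¬end (Proj.notPt (ready-fire ro rr i lab-i) λ u∈ → u∉ (∈pt⇒∈ptᴺ u∈))
  ⇝-occursWithin-role {u} ro (skip ¬fires cs subs) hb rr@(rp , _) ¬end
    with uniform-bound (λ i D → OccursWithin u D (gnode (cs i))) occursWithin-mono (λ i →
           ⇝-occursWithin-role ro (subs i) (hereditarilyBounded-child hb i) (ready-child ro rr ¬fires i) ¬end)
  ... | D , ch = suc D , next (λ x → ¬fires (roleProj-top ro rp x)) ch

  ⇝-bounded : ∀ {g g′} → g ⇝ g′ → HereditarilyBounded g →
              Ready r plus s g → Ready s amp r g → Bounded g′
  ⇝-bounded red hb rr rs t ¬¬t∈ with t ≟ℕ r | t ≟ℕ s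
  ... | yes refl | _ =
    ⇝-occursWithin-role sender red hb rr λ end →
      ¬¬t∈ (projᴺ-end⇒∉ptᴺ (⇝-projᴺ-role sender red rr) end)
  ... | no _ | yes refl =
    ⇝-occursWithin-role receiver red hb rs λ end →
      ¬¬t∈ (projᴺ-end⇒∉ptᴺ (⇝-projᴺ-role receiver red rs) end)
  ... | no t≢r | no t≢s with hb [] t (λ t∉ → ¬¬t∈ λ t∈ → t∉ (⇝-∈ptᴺ red t∈))
  ...   | D , occ = D , ⇝-occursWithin t≢r t≢s red occ

  ⇝-hereditarilyBounded : ∀ {g g′} → g ⇝ g′ → HereditarilyBounded g →
                          Ready r plus s g → Ready s amp r g → HereditarilyBounded g′
  ⇝-hereditarilyBounded (fire i _)             hb _  _  σ       = hb (i ∷ σ)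
  ⇝-hereditarilyBounded red@(skip _ _ _)       hb rr rs []      = ⇝-bounded red hb rr rs
  ⇝-hereditarilyBounded (skip ¬fires _ subs)   hb rr rs (i ∷ σ) =
    ⇝-hereditarilyBounded (subs i) (hereditarilyBounded-child hb i)
      (ready-child sender rr ¬fires i) (ready-child receiver rs ¬fires i) σ

  -- The bound on r's first occurrence makes the construction of the reduct well founded.
  ⇝-exists : ∀ {D g} → OccursWithin r D g → Ready r plus s g → Σ GNode (g ⇝_)
  ⇝-exists ended (roleProj _ (notPt , _) _ _ _ shape , _) = ⊥-elim (lcom≢lend shape (notPt ∉ptᴺ-gend))
  ⇝-exists (now x) (rp , j , lab-j) with roleProj-top sender rp x
  ... | refl , refl with roleProj-label⁻ sender rp j lab-j
  ...   | i , lab-i = _ , fire i lab-i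
  ⇝-exists {g = g} (next ¬x ch) rr =
    _ , skip ¬fires (λ i → fromNode (proj₁ (reduct i))) (λ i → proj₂ (reduct i))
    where
      ¬fires : ¬ FiresAtRoot g
      ¬fires (p≡r , _) = ¬x (inj₁ (sym p≡r))
      reduct : (i : Choice g) → Σ GNode (gnode (child g i) ⇝_)
      reduct i = ⇝-exists (ch i) (ready-child sender rr ¬fires i)

update : (Part → Maybe LType) → Part → Maybe LType → Part → Maybe LType
update f p m t with t ≟ℕ p
... | yes _ = m
... | no  _ = f t

infixl 30 _[_≔_]

_[_≔_] : Env → Part → Maybe LType → Env
Δ [ p ≔ m ] = record { map = update (map Δ) p m ; dom = p ∷ dom Δ ; finite = finite′ }
  where
    finite′ : ∀ t T → update (map Δ) p m t ≡ just T → t ∈ p ∷ dom Δ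
    finite′ t T eq with t ≟ℕ p
    ... | yes t≡p = here t≡p
    ... | no  _   = there (finite Δ t T eq)

[≔]-same : ∀ Δ p m → map (Δ [ p ≔ m ]) p ≡ m
[≔]-same Δ p m with p ≟ℕ p
... | yes _   = refl
... | no p≢p  = ⊥-elim (p≢p refl)

[≔]-other : ∀ Δ p m {t} → t ≢ p → map (Δ [ p ≔ m ]) t ≡ map Δ t
[≔]-other Δ p m {t} t≢p with t ≟ℕ p
... | yes t≡p = ⊥-elim (t≢p t≡p)
... | no  _   = refl

-- Case analysis on t ≟ p without abstracting it in goals that mention update.
≡-or-≢ : (t p : Part) → t ≡ p ⊎ t ≢ p
≡-or-≢ t p with t ≟ℕ p
... | yes t≡p = inj₁ t≡p
... | no  t≢p = inj₂ t≢p

∅ : Env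
∅ = record { map = λ _ → nothing ; dom = [] ; finite = λ _ _ () }

singleton : Part → LType → Env
singleton p T = ∅ [ p ≔ just T ]

Single-intro : ∀ {p T} Δ → map Δ p ≡ just T → (∀ t → t ≢ p → map Δ t ≡ nothing) → Single p T Δ
Single-intro Δ Δp others t = (λ { refl → Δp }) , others t

singleton-Single : ∀ p T → Single p T (singleton p T)
singleton-Single p T = Single-intro (singleton p T) ([≔]-same ∅ p (just T)) λ t → [≔]-other ∅ p (just T)

just≢nothing : ∀ {m : Maybe LType} {T} → m ≡ just T → m ≢ nothing
just≢nothing refl ()

UnionAt : Maybe LType → Maybe LType → Maybe LType → Set
UnionAt a b c = (a ≡ nothing × c ≡ b) ⊎ (b ≡ nothing × c ≡ a)

unionAt-left : ∀ {a b c T} → UnionAt a b c → a ≡ just T → c ≡ just T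
unionAt-left (inj₁ (refl , _)) ()
unionAt-left (inj₂ (_ , refl)) a≡ = a≡

unionAt-right : ∀ {a b c T} → UnionAt a b c → b ≡ just T → c ≡ just T
unionAt-right (inj₁ (_ , refl)) b≡ = b≡
unionAt-right (inj₂ (refl , _)) ()

unionAt-disjoint : ∀ {a b c T T′} → UnionAt a b c → a ≡ just T → b ≡ just T′ → ⊥
unionAt-disjoint (inj₁ (refl , _)) () _
unionAt-disjoint (inj₂ (refl , _)) _ ()

unionAt-cong : ∀ {a b c a′ b′ c′} → UnionAt a b c → UnionAt a′ b′ c′ →
               a′ ≡ a → b′ ≡ b → c′ ≡ c
unionAt-cong (inj₁ (refl , refl)) (inj₁ (refl , refl)) refl refl = refl
unionAt-cong (inj₁ (refl , refl)) (inj₂ (refl , refl)) refl refl = refl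
unionAt-cong (inj₂ (refl , refl)) (inj₁ (refl , refl)) refl refl = refl
unionAt-cong (inj₂ (refl , refl)) (inj₂ (refl , refl)) refl refl = refl

union-singleton : ∀ {a T Γ Θ} → map Γ a ≡ nothing → map Θ a ≡ just T →
                  (∀ t → t ≢ a → map Θ t ≡ map Γ t) → Union Γ (singleton a T) Θ
union-singleton {a} {T} Γa Θa others t with ≡-or-≢ t a
... | inj₁ refl = inj₁ (Γa , trans Θa (sym ([≔]-same ∅ a (just T))))
... | inj₂ t≢a  = inj₂ ([≔]-other ∅ a (just T) t≢a , others t t≢a)

record TakesBranch (d : Dir) (y : Part) (ℓ : Label) (before after : Maybe LType) : Set where
  constructor takesBranch
  field
    T        : LType
    n        : ℕ
    br       : Branches LType n
    inj      : DistinctLabels br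
    T-before : before ≡ just T
    shape    : node T ≡ lcom d y n br inj
    k        : Fin (suc n)
    lab-k    : lab (br k) ≡ ℓ
    T-after  : after ≡ just (cnt (br k))

takesBranch-transport : ∀ {d y ℓ a a′ c c′} →
                        (∀ {T} → a ≡ just T → c ≡ just T) → (∀ {T} → a′ ≡ just T → c′ ≡ just T) →
                        TakesBranch d y ℓ a a′ → TakesBranch d y ℓ c c′
takesBranch-transport before after tb = record
  { T = T ; n = n ; br = br ; inj = inj ; T-before = before T-before ; shape = shape
  ; k = k ; lab-k = lab-k ; T-after = after T-after }
  where open TakesBranch tb

record LocalStep (d : Dir) (p q : Part) (ℓ : Label) (Γ Γ′ : Env) : Set where
  constructor localStep
  field
    moves  : TakesBranch d q ℓ (map Γ p) (map Γ′ p)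
    others : ∀ t → t ≢ p → map Γ′ t ≡ map Γ t

localStep-axiom : ∀ {d p q n T Γ Γ′} {br : Branches LType n} {inj : DistinctLabels br} →
                  Single p T Γ → node T ≡ lcom d q n br inj → (k : Fin (suc n)) →
                  Single p (cnt (br k)) Γ′ → LocalStep d p q (lab (br k)) Γ Γ′
localStep-axiom {p = p} {n = n} {T} {br = br} {inj} single shape k single′ =
  localStep
    (record { T = T ; n = n ; br = br ; inj = inj ; T-before = proj₁ (single p) refl ; shape = shape
            ; k = k ; lab-k = refl ; T-after = proj₁ (single′ p) refl })
    λ t t≢p → trans (proj₂ (single′ t) t≢p) (sym (proj₂ (single t) t≢p))

localStep-frame : ∀ {d p q ℓ Γ Γ′ Δ Θ Θ′} → LocalStep d p q ℓ Γ Γ′ →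
                  Union Γ Δ Θ → Union Γ′ Δ Θ′ → LocalStep d p q ℓ Θ Θ′
localStep-frame {p = p} (localStep tb others) u u′ = localStep
  (takesBranch-transport (unionAt-left (u p)) (unionAt-left (u′ p)) tb)
  λ t t≢p → unionAt-cong (u t) (u′ t) (others t t≢p) refl

send-inversion : ∀ {Γ Γ′ p q ℓ S} → Γ —[ sendA p q ℓ S ]→ Γ′ → LocalStep plus p q ℓ Γ Γ′
send-inversion (ax-send single shape k single′) = localStep-axiom single shape k single′
send-inversion (frame {Δ = Δ} tr _ u u′) = localStep-frame {Δ = Δ} (send-inversion tr) u u′

recv-inversion : ∀ {Γ Γ′ p q ℓ S} → Γ —[ recvA p q ℓ S ]→ Γ′ → LocalStep amp p q ℓ Γ Γ′
recv-inversion (ax-recv single shape k single′) = localStep-axiom single shape k single′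
recv-inversion (frame {Δ = Δ} tr _ u u′) = localStep-frame {Δ = Δ} (recv-inversion tr) u u′

record Synchronises (r s : Part) (ℓ : Label) (Δ Δ′ : Env) : Set where
  constructor synchronises
  field
    r≢s      : r ≢ s
    sends    : TakesBranch plus s ℓ (map Δ r) (map Δ′ r)
    receives : TakesBranch amp r ℓ (map Δ s) (map Δ′ s)
    others   : ∀ t → t ≢ r → t ≢ s → map Δ′ t ≡ map Δ t

comm-inversion : ∀ {Δ Δ′ r s ℓ} → Δ —[ commA r s ℓ ]→ Δ′ → Synchronises r s ℓ Δ Δ′
comm-inversion {r = r} {s} (sync tr₁ tr₂ _ u u′) with send-inversion tr₁ | recv-inversion tr₂
... | localStep snd others₁ | localStep rcv others₂ = record
  { r≢s      = λ { refl → unionAt-disjoint (u r) (TakesBranch.T-before snd) (TakesBranch.T-before rcv) }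
  ; sends    = takesBranch-transport (unionAt-left (u r)) (unionAt-left (u′ r)) snd
  ; receives = takesBranch-transport (unionAt-right (u s)) (unionAt-right (u′ s)) rcv
  ; others   = λ t t≢r t≢s → unionAt-cong (u t) (u′ t) (others₁ t t≢r) (others₂ t t≢s) }
comm-inversion {r = r} {s} (frame tr _ u u′) = record
  { r≢s      = r≢s
  ; sends    = takesBranch-transport (unionAt-left (u r)) (unionAt-left (u′ r)) sends
  ; receives = takesBranch-transport (unionAt-left (u s)) (unionAt-left (u′ s)) receives
  ; others   = λ t t≢r t≢s → unionAt-cong (u t) (u′ t) (others t t≢r t≢s) refl }
  where open Synchronises (comm-inversion tr)

frame-participant : ∀ {α x p U T′} (Δ : Env) → map Δ x ≡ just U → x ≢ p →
                    Δ [ x ≔ nothing ] —[ α ]→ Δ [ x ≔ nothing ] [ p ≔ just T′ ] →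
                    Δ —[ α ]→ Δ [ p ≔ just T′ ]
frame-participant {x = x} {p} {U} {T′} Δ Δx x≢p tr =
  frame {Δ = singleton x U} tr (singleton-Single x U)
    (union-singleton {Γ = Δ₀} {Δ} ([≔]-same Δ x nothing) Δx
                     λ t t≢x → sym ([≔]-other Δ x nothing t≢x))
    (union-singleton {Γ = Δ₀ [ p ≔ just T′ ]} {Δ [ p ≔ just T′ ]} Δ₀′x
                     (trans ([≔]-other Δ p (just T′) x≢p) Δx) others′)
  where
    Δ₀ : Env
    Δ₀ = Δ [ x ≔ nothing ]
    Δ₀′x : map (Δ₀ [ p ≔ just T′ ]) x ≡ nothing
    Δ₀′x = trans ([≔]-other Δ₀ p (just T′) x≢p) ([≔]-same Δ x nothing)
    others′ : ∀ t → t ≢ x → map (Δ [ p ≔ just T′ ]) t ≡ map (Δ₀ [ p ≔ just T′ ]) t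
    others′ t t≢x with ≡-or-≢ t p
    ... | inj₁ refl = trans ([≔]-same Δ p (just T′)) (sym ([≔]-same Δ₀ p (just T′)))
    ... | inj₂ t≢p  = trans ([≔]-other Δ p (just T′) t≢p)
                        (sym (trans ([≔]-other Δ₀ p (just T′) t≢p) ([≔]-other Δ x nothing t≢x)))

-- The rest of Δ is framed around the step one participant at a time.
localStep-in-context : ∀ {α p T T′} (Δ : Env) → map Δ p ≡ just T →
                       (∀ {Γ Γ′} → Single p T Γ → Single p T′ Γ′ → Γ —[ α ]→ Γ′) →
                       Δ —[ α ]→ Δ [ p ≔ just T′ ]
localStep-in-context {α} {p} {T} {T′} Δ Δp step = go (dom Δ) Δ (λ t U _ → finite Δ t U) Δp
  where
    go : (L : List Part) (Δ : Env) → (∀ t U → t ≢ p → map Δ t ≡ just U → t ∈ L) →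
         map Δ p ≡ just T → Δ —[ α ]→ Δ [ p ≔ just T′ ]
    go [] Δ covered Δp =
      step (Single-intro Δ Δp others-nothing)
           (Single-intro (Δ [ p ≔ just T′ ]) ([≔]-same Δ p (just T′))
                         λ t t≢p → trans ([≔]-other Δ p (just T′) t≢p) (others-nothing t t≢p))
      where
        others-nothing : ∀ t → t ≢ p → map Δ t ≡ nothing
        others-nothing t t≢p with map Δ t in Δt
        ... | nothing = refl
        ... | just U with covered t U t≢p Δt
        ...   | ()
    go (x ∷ L) Δ covered Δp with x ≟ℕ p | map Δ x in Δx
    ... | yes x≡p | _ =
      go L Δ (λ t U t≢p Δt → Any.tail (λ t≡x → t≢p (trans t≡x x≡p)) (covered t U t≢p Δt)) Δp
    ... | no _ | nothing =
      go L Δ (λ t U t≢p Δt → Any.tail (λ { refl → just≢nothing Δt Δx }) (covered t U t≢p Δt)) Δp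
    ... | no x≢p | just U =
      frame-participant Δ Δx x≢p
        (go L (Δ [ x ≔ nothing ]) covered₀ (trans ([≔]-other Δ x nothing λ p≡x → x≢p (sym p≡x)) Δp))
      where
        covered₀ : ∀ t U′ → t ≢ p → map (Δ [ x ≔ nothing ]) t ≡ just U′ → t ∈ L
        covered₀ t U′ t≢p Δ₀t with ≡-or-≢ t x
        ... | inj₁ refl = ⊥-elim (just≢nothing Δ₀t ([≔]-same Δ x nothing))
        ... | inj₂ t≢x  =
          Any.tail t≢x (covered t U′ t≢p (trans (sym ([≔]-other Δ x nothing t≢x)) Δ₀t))

Conforms : GNode → Part → LType → Set
Conforms g t T = (∃ λ U → Projᴺ g t U × T ≤L U) ⊎ (IsEnd T × ¬ t ∈ptᴺ g)

record Assoc (Δ : Env) (g : GNode) : Set where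
  field
    bounded : HereditarilyBounded g
    defined : ∀ t → t ∈ptᴺ g → ∃ λ T → map Δ t ≡ just T
    typed   : ∀ t T → map Δ t ≡ just T → Conforms g t T

assoc-participant : ∀ {Δ g t} → Assoc Δ g → t ∈ptᴺ g →
                    ∃ λ T → map Δ t ≡ just T × ∃ λ U → Projᴺ g t U × T ≤L U
assoc-participant {t = t} assoc t∈ with Assoc.defined assoc t t∈
... | T , Δt with Assoc.typed assoc t T Δt
...   | inj₁ typed    = T , Δt , typed
...   | inj₂ (_ , t∉) = ⊥-elim (t∉ t∈)

comm-enabled : ∀ {Δ a b Ta Tb n m} {tbr : Branches LType n} {tinj : DistinctLabels tbr}
               {sbr : Branches LType m} {sinj : DistinctLabels sbr} → a ≢ b →
               map Δ a ≡ just Ta → node Ta ≡ lcom plus b n tbr tinj →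
               map Δ b ≡ just Tb → node Tb ≡ lcom amp a m sbr sinj →
               (k : Fin (suc n)) (i : Fin (suc m)) →
               lab (sbr i) ≡ lab (tbr k) → srt (tbr k) ≤S srt (sbr i) →
               Δ —[ commA a b (lab (tbr k)) ]→
comm-enabled {Δ} {a} {b} {Tb = Tb} {tbr = tbr} {sbr = sbr} a≢b Δa Ta-shape Δb Tb-shape k i same-label sort-ok =
  Γ₁′ [ b ≔ just (cnt (sbr i)) ] , sync send recv sort-ok union union′
  where
    Γ₁ : Env
    Γ₁ = Δ [ b ≔ nothing ]
    Γ₁′ : Env
    Γ₁′ = Γ₁ [ a ≔ just (cnt (tbr k)) ]
    send : Γ₁ —[ sendA a b (lab (tbr k)) (srt (tbr k)) ]→ Γ₁′
    send = localStep-in-context Γ₁ (trans ([≔]-other Δ b nothing a≢b) Δa)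
             λ single single′ → ax-send single Ta-shape k single′
    recv : singleton b Tb —[ recvA b a (lab (tbr k)) (srt (sbr i)) ]→ singleton b (cnt (sbr i))
    recv = subst (λ l → singleton b Tb —[ recvA b a l (srt (sbr i)) ]→ singleton b (cnt (sbr i))) same-label
             (ax-recv (singleton-Single b Tb) Tb-shape i (singleton-Single b (cnt (sbr i))))
    union : Union Γ₁ (singleton b Tb) Δ
    union = union-singleton {Γ = Γ₁} {Δ} ([≔]-same Δ b nothing) Δb
              λ t t≢b → sym ([≔]-other Δ b nothing t≢b)
    union′ : Union Γ₁′ (singleton b (cnt (sbr i))) (Γ₁′ [ b ≔ just (cnt (sbr i)) ])
    union′ = union-singleton {Γ = Γ₁′} {Γ₁′ [ b ≔ just (cnt (sbr i)) ]}
               (trans ([≔]-other Γ₁ a _ λ b≡a → a≢b (sym b≡a)) ([≔]-same Δ b nothing))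
               ([≔]-same Γ₁′ b _) λ t t≢b → [≔]-other Γ₁′ b _ t≢b

-- The sender's first branch exists in its projection, hence in the global
-- type, hence in the receiver's projection, hence in the receiver's type.
root-enabled : ∀ {Δ a b a≢b n} {br : Branches GType n} {inj : DistinctLabels br} →
               Assoc Δ (gcom a b a≢b n br inj) → ∃ λ ℓ → Δ —[ commA a b ℓ ]→
root-enabled {a≢b = a≢b} {br = br} assoc
  with assoc-participant assoc (top (inj₁ refl)) | assoc-participant assoc (top (inj₂ refl))
... | Ta , Δa , Ua , (_ , _ , out , _) , Ta≤Ua | Tb , Δb , Ub , (_ , inp , _ , _) , Tb≤Ub
  with unmatch (out refl) | unmatch (inp refl)
... | ubr , _ , Ua-shape , fa | vbr , _ , Ub-shape , fb
  with subStep-⊕ʳ (subst (SubStep (node Ta)) Ua-shape (_≤L_.unfold Ta≤Ua))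
     | subStep-&ʳ (subst (SubStep (node Tb)) Ub-shape (_≤L_.unfold Tb≤Ub))
... | _ , tbr , _ , Ta-shape , subA | _ , sbr , _ , Tb-shape , subB with subA fz
... | j , lab-j , sort-j , _ with subB j
... | i , lab-i , sort-i , _ =
  lab (tbr fz) , comm-enabled a≢b Δa Ta-shape Δb Tb-shape fz i same-label sort-ok
  where
    open ≡-Reasoning
    same-label : lab (sbr i) ≡ lab (tbr fz)
    same-label = begin
      lab (sbr i)   ≡⟨ lab-i ⟩
      lab (vbr j)   ≡⟨ proj₁ (fb j) ⟩
      lab (br j)    ≡⟨ sym (proj₁ (fa j)) ⟩
      lab (ubr j)   ≡⟨ sym lab-j ⟩
      lab (tbr fz)  ∎
    same-sort : srt (vbr j) ≡ srt (ubr j)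
    same-sort = trans (proj₁ (proj₂ (fb j))) (sym (proj₁ (proj₂ (fa j))))
    sort-ok : srt (tbr fz) ≤S srt (sbr i)
    sort-ok = ≤S-trans sort-j (subst (_≤S srt (sbr i)) same-sort sort-i)

module _ {r s : Part} {ℓ : Label} where
  open Fire r s ℓ

  sender-ready : ∀ {Δ g a′} → Assoc Δ g → TakesBranch plus s ℓ (map Δ r) a′ →
                 Σ (Ready r plus s g) λ rr → ∀ {T′} → a′ ≡ just T′ → T′ ≤L continuation rr
  sender-ready assoc (takesBranch T _ _ _ before shape k lab-k after) with Assoc.typed assoc r T before
  ... | inj₂ (end , _) = ⊥-elim (lcom≢lend shape end)
  ... | inj₁ (U , proj , T≤U)
    with subStep-⊕ˡ (subst (λ nd → SubStep nd (node U)) shape (_≤L_.unfold T≤U))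
  ...   | n′ , ubr , uinj , U-shape , sub with sub k
  ...     | j , lab-eq , _ , next≤ =
    (roleProj U proj n′ ubr uinj U-shape , j , trans (sym lab-eq) lab-k) ,
    λ a′≡ → subst (_≤L cnt (ubr j)) (just-injective (trans (sym after) a′≡)) next≤

  receiver-ready : ∀ {Δ g g′ a′} → Assoc Δ g → TakesBranch amp r ℓ (map Δ s) a′ → g ⇝ g′ →
                   Σ (Ready s amp r g) λ rr → ∀ {T′} → a′ ≡ just T′ → T′ ≤L continuation rr
  receiver-ready assoc (takesBranch T _ br inj before shape k lab-k after) red with Assoc.typed assoc s T before
  ... | inj₂ (end , _) = ⊥-elim (lcom≢lend shape end)
  ... | inj₁ (U , proj , T≤U)
    with subStep-&ˡ (subst (λ nd → SubStep nd (node U)) shape (_≤L_.unfold T≤U))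
  ...   | n′ , vbr , vinj , U-shape , sub with ⇝-label receiver red (roleProj U proj n′ vbr vinj U-shape)
  ...     | j , lab-j with sub j
  ...       | i , lab-eq , _ , next≤ =
    (roleProj U proj n′ vbr vinj U-shape , j , lab-j) ,
    λ a′≡ → subst (_≤L cnt (vbr j)) (just-injective (trans (sym after) a′≡))
                  (subst (λ k′ → cnt (br k′) ≤L cnt (vbr j)) i≡k next≤)
    where
      i≡k : i ≡ k
      i≡k = inj (trans lab-eq (trans lab-j (sym lab-k)))

  assoc-⇝ : ∀ {Δ Δ′ g g′} → Assoc Δ g → Synchronises r s ℓ Δ Δ′ → g ⇝ g′ →
            (rr : Ready r plus s g) → (∀ {T} → map Δ′ r ≡ just T → T ≤L continuation rr) →
            (rs : Ready s amp r g) → (∀ {T} → map Δ′ s ≡ just T → T ≤L continuation rs) →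
            Assoc Δ′ g′
  assoc-⇝ {Δ} {Δ′} {g} {g′} assoc (synchronises _ sends receives others) red rr r≤ rs s≤ = record
    { bounded = ⇝-hereditarilyBounded red (Assoc.bounded assoc) rr rs ; defined = defined ; typed = typed }
    where
      defined : ∀ t → t ∈ptᴺ g′ → ∃ λ T → map Δ′ t ≡ just T
      defined t t∈ with t ≟ℕ r | t ≟ℕ s
      ... | yes refl | _        = _ , TakesBranch.T-after sends
      ... | no _     | yes refl = _ , TakesBranch.T-after receives
      ... | no t≢r   | no t≢s with Assoc.defined assoc t (⇝-∈ptᴺ red t∈)
      ...   | T , Δt = T , trans (others t t≢r t≢s) Δt
      typed : ∀ t T → map Δ′ t ≡ just T → Conforms g′ t T
      typed t T Δ′t with t ≟ℕ r | t ≟ℕ s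
      ... | yes refl | _        = inj₁ (continuation rr , ⇝-projᴺ-role sender red rr , r≤ Δ′t)
      ... | no _     | yes refl = inj₁ (continuation rs , ⇝-projᴺ-role receiver red rs , s≤ Δ′t)
      ... | no t≢r   | no t≢s with Assoc.typed assoc t T (trans (sym (others t t≢r t≢s)) Δ′t)
      ...   | inj₁ (U , proj , T≤U) = inj₁ (U , ⇝-projᴺ-uninvolved t≢r t≢s red proj , T≤U)
      ...   | inj₂ (end , t∉)       = inj₂ (end , λ t∈ → t∉ (⇝-∈ptᴺ red t∈))

  assoc-step : ∀ {Δ Δ′ g} → Assoc Δ g → Δ —[ commA r s ℓ ]→ Δ′ →
               Σ GNode λ g′ → Assoc Δ′ g′ × g ⇝ g′
  assoc-step assoc tr with comm-inversion tr
  ... | synced@(synchronises _ sends receives _) with sender-ready assoc sends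
  ...   | rr@(roleProj _ (notPt , _) _ _ _ shape , _) , r≤
    with ⇝-exists (proj₂ (Assoc.bounded assoc [] r λ r∉ → lcom≢lend shape (notPt r∉))) rr
  ...     | g′ , red with receiver-ready assoc receives red
  ...       | rs , s≤ = g′ , assoc-⇝ assoc synced red rr r≤ rs s≤ , red

⊑⇒Assoc : ∀ Γ G → Balanced G → Γ ⊑ G → Assoc Γ (gnode G)
⊑⇒Assoc Γ G bal (participants , others) = record
  { bounded = hb ; defined = defined ; typed = typed }
  where
    hb : HereditarilyBounded (gnode G)
    hb = balanced⇒hereditarilyBounded G bal
    defined : ∀ t → t ∈ptᴺ gnode G → ∃ λ T → map Γ t ≡ just T
    defined t t∈ with participants t (∈ptᴺ⇒∈pt t∈)
    ... | T , Γt , _ = T , Γt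
    projection : ∀ {t T} → map Γ t ≡ just T → t ∈ptᴺ gnode G →
                 ∃ λ U → Projᴺ (gnode G) t U × T ≤L U
    projection {t} Γt t∈ with participants t (∈ptᴺ⇒∈pt t∈)
    ... | _ , Γt′ , U , proj , T≤U with just-injective (trans (sym Γt′) Γt)
    ...   | refl = U , Proj⇒Projᴺ proj , T≤U
    typed : ∀ t T → map Γ t ≡ just T → Conforms (gnode G) t T
    typed t T Γt with isEnd? T
    ... | yes end = inj₂ (end , λ t∈ → let U , proj , T≤U = projection Γt t∈ in
                                        projᴺ-end⇒∉ptᴺ proj (≤L-preserves-end T≤U end) t∈)
    ... | no ¬end = inj₁ (projection Γt (∈ptᴺ-stable hb ¬¬t∈))
      where
        ¬¬t∈ : ¬ ¬ t ∈ptᴺ gnode G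
        ¬¬t∈ t∉ with others t (λ t∈ → t∉ (∈pt⇒∈ptᴺ t∈))
        ... | inj₁ Γt≡nothing         = just≢nothing Γt Γt≡nothing
        ... | inj₂ (_ , Γt′ , end′) with just-injective (trans (sym Γt′) Γt)
        ...   | refl = ¬end end′

assoc-cong : ∀ {Γ Δ g} → Assoc Γ g → (∀ t → map Δ t ≡ map Γ t) → Assoc Δ g
assoc-cong assoc Δ≗Γ = record
  { bounded = Assoc.bounded assoc
  ; defined = λ t t∈ → let T , Γt = Assoc.defined assoc t t∈ in T , trans (Δ≗Γ t) Γt
  ; typed   = λ t T Δt → Assoc.typed assoc t T (trans (sym (Δ≗Γ t)) Δt) }

assoc-⟶* : ∀ {Γ Γ′ g} → Assoc Γ g → Γ ⟶* Γ′ → ∃ λ g′ → Assoc Γ′ g′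
assoc-⟶* {g = g} assoc ε                         = g , assoc
assoc-⟶* assoc ((_ , _ , _ , tr) ◅ steps) = assoc-⟶* (proj₁ (proj₂ (assoc-step assoc tr))) steps

data PendingNode (x p q : Part) : LNode → Set where
  sending   : ∀ {n} {br : Branches LType n} {inj : DistinctLabels br} →
              x ≡ p → PendingNode x p q (lcom plus q n br inj)
  receiving : ∀ {n} {br : Branches LType n} {inj : DistinctLabels br} →
              x ≡ q → PendingNode x p q (lcom amp p n br inj)

Pending : Env → Part → Part → Part → Set
Pending Δ x p q = ∃ λ T → map Δ x ≡ just T × PendingNode x p q (node T)

pendingNode-¬end : ∀ {x p q nd} → PendingNode x p q nd → nd ≢ lend
pendingNode-¬end (sending _)   ()
pendingNode-¬end (receiving _) ()

pendingNode-plus : ∀ {x p q w n nd} {br : Branches LType n} {inj : DistinctLabels br} →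
                   PendingNode x p q nd → nd ≡ lcom plus w n br inj → x ≡ p × w ≡ q
pendingNode-plus (sending x≡p) refl = x≡p , refl
pendingNode-plus (receiving _) ()

pendingNode-amp : ∀ {x p q w n nd} {br : Branches LType n} {inj : DistinctLabels br} →
                  PendingNode x p q nd → nd ≡ lcom amp w n br inj → x ≡ q × w ≡ p
pendingNode-amp (receiving x≡q) refl = x≡q , refl
pendingNode-amp (sending _)     ()

send-pending : ∀ {Γ Γ′ p q ℓ S} → Γ —[ sendA p q ℓ S ]→ Γ′ → Pending Γ p p q
send-pending tr with send-inversion tr
... | localStep (takesBranch T _ _ _ before shape _ _ _) _ =
  T , before , subst (PendingNode _ _ _) (sym shape) (sending refl)

recv-pending : ∀ {Γ Γ′ p q ℓ S} → Γ —[ recvA q p ℓ S ]→ Γ′ → Pending Γ q p q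
recv-pending tr with recv-inversion tr
... | localStep (takesBranch T _ _ _ before shape _ _ _) _ =
  T , before , subst (PendingNode _ _ _) (sym shape) (receiving refl)

pending-¬¬∈ptᴺ : ∀ {Δ g x p q} → Assoc Δ g → Pending Δ x p q → ¬ ¬ x ∈ptᴺ g
pending-¬¬∈ptᴺ {x = x} assoc (T , Δx , pn) x∉ with Assoc.typed assoc x T Δx
... | inj₁ (U , (notPt , _) , T≤U) = pendingNode-¬end pn (≤L-reflects-end T≤U (notPt x∉))
... | inj₂ (end , _)               = pendingNode-¬end pn end

pending-root : ∀ {Δ x p q a b a≢b n} {br : Branches GType n} {inj : DistinctLabels br} →
               Assoc Δ (gcom a b a≢b n br inj) → Pending Δ x p q → InNode x (gcom a b a≢b n br inj) →
               a ≡ p × b ≡ q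
pending-root assoc (T , Δx , pn) x∈ with assoc-participant assoc (top x∈)
pending-root assoc (T , Δx , pn) (inj₁ refl) | T′ , Δx′ , U , (_ , _ , out , _) , T′≤U
  with just-injective (trans (sym Δx′) Δx) | unmatch (out refl)
... | refl | _ , _ , U-shape , _ with subStep-⊕ʳ (subst (SubStep (node T)) U-shape (_≤L_.unfold T′≤U))
...   | _ , _ , _ , T-shape , _ = pendingNode-plus pn T-shape
pending-root assoc (T , Δx , pn) (inj₂ refl) | T′ , Δx′ , U , (_ , inp , _ , _) , T′≤U
  with just-injective (trans (sym Δx′) Δx) | unmatch (inp refl)
... | refl | _ , _ , U-shape , _ with subStep-&ʳ (subst (SubStep (node T)) U-shape (_≤L_.unfold T′≤U))
...   | _ , _ , _ , T-shape , _ with pendingNode-amp pn T-shape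
...     | x≡q , a≡p = a≡p , x≡q

pending-not-moved : ∀ {Δ Δ′ x p q c d ℓ} → Pending Δ x p q → Δ —[ commA c d ℓ ]→ Δ′ →
                    ¬ (c ≡ p × d ≡ q) → x ≢ c × x ≢ d
pending-not-moved {x = x} {c = c} {d} (T , Δx , pn) tr ¬pq with comm-inversion tr
... | synchronises _ (takesBranch _ _ _ _ c-before c-shape _ _ _) (takesBranch _ _ _ _ d-before d-shape _ _ _) _ =
  x≢c , x≢d
  where
    x≢c : x ≢ c
    x≢c refl with just-injective (trans (sym c-before) Δx)
    ... | refl with pendingNode-plus pn c-shape
    ...   | x≡p , d≡q = ¬pq (x≡p , d≡q)
    x≢d : x ≢ d
    x≢d refl with just-injective (trans (sym d-before) Δx)
    ... | refl with pendingNode-amp pn d-shape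
    ...   | x≡q , c≡p = ¬pq (c≡p , x≡q)

pending-others : ∀ {Δ Δ′ x p q c d ℓ} → Pending Δ x p q → Δ —[ commA c d ℓ ]→ Δ′ →
                 x ≢ c → x ≢ d → Pending Δ′ x p q
pending-others {x = x} (T , Δx , pn) tr x≢c x≢d =
  T , trans (Synchronises.others (comm-inversion tr) x x≢c x≢d) Δx , pn

RootedAt : Part → ℕ → Part → Part → GNode → Set
RootedAt x D a b gend                 = ⊥
RootedAt x D a b (gcom a′ b′ _ n br _) =
  a′ ≡ a × b′ ≡ b × ((i : Fin (suc n)) → OccursWithin x D (gnode (cnt (br i))))

step-rooted : ∀ {Δ Δ′ g x p q a b c d ℓ D} → Assoc Δ g → RootedAt x D a b g → Pending Δ x p q →
              Δ —[ commA c d ℓ ]→ Δ′ → ¬ (c ≡ p × d ≡ q) →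
              Pending Δ′ x p q × Σ GNode λ g′ → Assoc Δ′ g′ ×
                (OccursWithin x D g′ ⊎ (¬ (a ≡ c × b ≡ d) × RootedAt x D a b g′))
step-rooted {g = gcom _ _ _ _ _ _} {c = c} {d} {ℓ} assoc (refl , refl , ch) pend tr ¬pq
  with pending-not-moved pend tr ¬pq | assoc-step assoc tr
... | x≢c , x≢d | g′ , assoc′ , Fire.fire i _ =
  pending-others pend tr x≢c x≢d , g′ , assoc′ , inj₁ (ch i)
... | x≢c , x≢d | g′ , assoc′ , Fire.skip ¬fires _ subs =
  pending-others pend tr x≢c x≢d , g′ , assoc′ ,
  inj₂ (¬fires , refl , refl , λ i → Fire.⇝-occursWithin c d ℓ x≢c x≢d (subs i) (ch i))

stepIdx⇒envIdx-suc : ∀ {L j} → StepIdx L j → EnvIdx L (suc j)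
stepIdx⇒envIdx-suc {just _}  j<m = j<m
stepIdx⇒envIdx-suc {nothing} _   = tt

envIdx-suc⇒stepIdx : ∀ {L j} → EnvIdx L (suc j) → StepIdx L j
envIdx-suc⇒stepIdx {just _}  j<m = j<m
envIdx-suc⇒stepIdx {nothing} _   = tt

stepIdx-≤ : ∀ {L j k} → j ≤ k → StepIdx L k → StepIdx L j
stepIdx-≤ {just _}  j≤k k<m = ≤-trans (s≤s j≤k) k<m
stepIdx-≤ {nothing} _   _   = tt

stepIdx⇒envIdx : ∀ {L j} → StepIdx L j → EnvIdx L j
stepIdx⇒envIdx {just _}  j<m = <⇒≤ j<m
stepIdx⇒envIdx {nothing} _   = tt

module _ (π : RPath) (fair : Fair π) where

  assoc-at : ∀ {g₀} → Assoc (env π 0) g₀ → ∀ n → EnvIdx (len π) n → ∃ λ g → Assoc (env π n) g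
  assoc-at {g₀} assoc₀ zero    _   = g₀ , assoc₀
  assoc-at      assoc₀ (suc n) idx =
    let sn = envIdx-suc⇒stepIdx idx
        _ , assoc = assoc-at assoc₀ n (stepIdx⇒envIdx sn)
        g′ , assoc′ , _ = assoc-step assoc (step π n sn)
    in g′ , assoc′

  eventually-≤ : ∀ {n j p q} → n ≤ j → Eventually π j p q → Eventually π n p q
  eventually-≤ n≤j (k , j≤k , sk , ℓ′ , lab-k) = k , ≤-trans n≤j j≤k , sk , ℓ′ , lab-k

  record Stage (D : ℕ) (x p q : Part) (j : ℕ) : Set where
    constructor stage
    field
      idx     : EnvIdx (len π) j
      g       : GNode
      assoc   : Assoc (env π j) g
      occurs  : OccursWithin x D g
      pending : Pending (env π j) x p q

  until-root-fires : ∀ {D x p q a b ℓk k} → StepIdx (len π) k → plab π k ≡ (a , b , ℓk) →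
                     ∀ m j {g} → j + m ≡ k → Assoc (env π j) g → RootedAt x D a b g →
                     Pending (env π j) x p q →
                     Eventually π j p q ⊎ ∃ λ j′ → j ≤ j′ × Stage D x p q j′
  until-root-fires {p = p} {q} sk lab-k m j j+m≡k assoc rooted pend
    with stepIdx-≤ (subst (j ≤_) j+m≡k (m≤m+n j m)) sk
  ... | sj with proj₁ (plab π j) ≟ℕ p ×-dec proj₁ (proj₂ (plab π j)) ≟ℕ q
  ...   | yes (c≡p , d≡q) = inj₁ (j , ≤-refl , sj , _ , cong₂ _,_ c≡p (cong₂ _,_ d≡q refl))
  ...   | no ¬pq with step-rooted assoc rooted pend (step π j sj) ¬pq
  ...     | pend′ , g′ , assoc′ , inj₁ occ =
    inj₂ (suc j , n≤1+n j , stage (stepIdx⇒envIdx-suc sj) g′ assoc′ occ pend′)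
  ...     | pend′ , g′ , assoc′ , inj₂ (¬fires , rooted′) with m
  ...       | zero = ⊥-elim (¬fires (sym (cong proj₁ lab-j) , sym (cong (λ l → proj₁ (proj₂ l)) lab-j)))
    where
      lab-j : plab π j ≡ _
      lab-j = subst (λ i → plab π i ≡ _) (sym (trans (sym (+-identityʳ j)) j+m≡k)) lab-k
  ...       | suc m′
    with until-root-fires sk lab-k m′ (suc j) (trans (sym (+-suc j m′)) j+m≡k) assoc′ rooted′ pend′
  ...         | inj₁ ev                = inj₁ (eventually-≤ (n≤1+n j) ev)
  ...         | inj₂ (j′ , sj≤j′ , st) = inj₂ (j′ , ≤-trans (n≤1+n j) sj≤j′ , st)

  -- Induction on the depth of x's first occurrence: fairness fires the root.
  pending-eventually : ∀ D j {x p q} → Stage D x p q j → Eventually π j p q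
  pending-eventually D j (stage _ _ assoc ended pend) = ⊥-elim (pending-¬¬∈ptᴺ assoc pend ∉ptᴺ-gend)
  pending-eventually D j (stage idx _ assoc (now x∈) pend) with pending-root assoc pend x∈
  ... | refl , refl = let ℓ , tr = root-enabled assoc in fair j idx _ _ ℓ tr
  pending-eventually (suc D) j (stage idx _ assoc (next ¬x ch) pend) with root-enabled assoc
  ... | ℓ , tr with fair j idx _ _ ℓ tr
  ...   | k , j≤k , sk , ℓk , lab-k
    with until-root-fires sk lab-k (k ∸ j) j (m+[n∸m]≡n j≤k) assoc (refl , refl , ch) pend
  ...     | inj₁ ev                 = ev
  ...     | inj₂ (j′ , j≤j′ , st)   = eventually-≤ j≤j′ (pending-eventually D j′ st)

  live-path : ∀ {g₀} → Assoc (env π 0) g₀ → LivePath π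
  live-path assoc₀ n idx = (λ p q ℓ S (_ , tr) → eventually (send-pending tr))
                         , (λ p q ℓ S (_ , tr) → eventually (recv-pending tr))
    where
      eventually : ∀ {x p q} → Pending (env π n) x p q → Eventually π n p q
      eventually {x} pend with assoc-at assoc₀ n idx
      ... | g , assoc with Assoc.bounded assoc [] x (pending-¬¬∈ptᴺ assoc pend)
      ...   | D , occ = pending-eventually D n (stage idx g assoc occ pend)

mainTheorem4 : (Γ : Env) (G : GType) → Balanced G → Projectable G → Γ ⊑ G → Live Γ
mainTheorem4 Γ G bal _ Γ⊑G Γ′ Γ⟶*Γ′ π π₀≗Γ′ fair
  with assoc-⟶* (⊑⇒Assoc Γ G bal Γ⊑G) Γ⟶*Γ′
... | g , assoc = live-path π fair (assoc-cong assoc π₀≗Γ′)
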